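{- Let $m\ge1$. Two binary trees $T,T'$ with $m$ nodes are L-equivalent if and only if the bipartite plane trees $\phi(T)$ and $\phi(T')$ coincide up to reordering of the children of black vertices. Consequently the L-classes of binary trees with $m$ nodes are indexed by the black-rooted bicolored plane trees with $m+1$ vertices, taken up to reordering of the children of the black vertices.
   Context: Binary trees are (incomplete) binary trees: each node has an optional left child and an optional right child. For a node $v$ of a binary tree $T$ that is either the root or the right child of its parent, and that has a right child $w$, let $T_1$ be the left subtree of $v$ and $T_2$ the left subtree of $w$; $L_v(T)$ is the tree obtained by exchanging $T_1$ and $T_2$. L-equivalence is the equivalence relation generated by $T\sim L_v(T)$; its classes are the L-classes. Encoding $\phi$: number the nodes of $T$ in infix order $1,\dots,m$. Let $L(T)$ (resp. $R(T)$) be the set partition of $\{1,\dots,m\}$ whose blocks are the maximal sets of nodes connected by left edges (resp. right edges). Blocks of $L(T)$ are white vertices, blocks of $R(T)$ are black vertices. $\phi(T)$ is the bipartite plane tree whose root is the block of $R(T)$ containing the root of $T$, and in which the children of a vertex (block) $N$ are the blocks of the other color that intersect $N$, except the parent of $N$, ordered by increasing value of the (single) element of their intersection with $N$. A bicolored plane tree is black-rooted if its root is black and adjacent vertices have different colors. -}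

module Defs where

open import Data.Nat using (ℕ; zero; suc; _+_)
open import Data.List using (List; []; _∷_; _++_; [_])
open import Data.List.Relation.Binary.Pointwise using (Pointwise)
open import Data.List.Relation.Binary.Permutation.Homogeneous using (Permutation)
open import Relation.Binary.Construct.Closure.Equivalence using (EqClosure)

data BT : Set where
  leaf : BT
  node : BT → BT → BT

nodes : BT → ℕ
nodes leaf       = 0
nodes (node l r) = suc (nodes l + nodes r)

-- StepA : move applied at some node v of the tree which is allowed to be
--         the current root (the current root is the root of T or a right child).
-- StepN : move inside a subtree whose root is a left child (so the move
--         may not be applied at that root itself).

mutual
  data StepA : BT → BT → Set where
    here  : ∀ t1 t2 r → StepA (node t1 (node t2 r)) (node t2 (node t1 r))
    left  : ∀ {l l'} r → StepN l l' → StepA (node l r) (node l' r)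
    right : ∀ l {r r'} → StepA r r' → StepA (node l r) (node l r')

  data StepN : BT → BT → Set where
    left  : ∀ {l l'} r → StepN l l' → StepN (node l r) (node l' r)
    right : ∀ l {r r'} → StepA r r' → StepN (node l r) (node l r')

LMove : BT → BT → Set
LMove = StepA

_∼L_ : BT → BT → Set
_∼L_ = EqClosure LMove

-- Plane trees. The root is black, colours alternate with depth
-- (so every plane tree is read as a black-rooted bicolored plane tree).

data PTree : Set where
  pt : List PTree → PTree

mutual
  vertices : PTree → ℕ
  vertices (pt xs) = suc (verticesL xs)

  verticesL : List PTree → ℕ
  verticesL []       = 0
  verticesL (x ∷ xs) = vertices x + verticesL xs

mutual
  data _≈B_ : PTree → PTree → Set where
    black : ∀ {xs ys} → Permutation _≈W_ xs ys → pt xs ≈B pt ys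

  data _≈W_ : PTree → PTree → Set where
    white : ∀ {xs ys} → Pointwise _≈B_ xs ys → pt xs ≈W pt ys

-- The encoding φ.
--   spineW t   : the white vertices (L-blocks) topped at the nodes of the
--                right spine of t, in infix order;
--   leftChainB t : the black vertices (R-blocks) topped at the nodes of the
--                left spine of t, in infix order (deepest first).
-- An R-block with top node x = node l r, seen as a child of the L-block
-- of x, has as children the L-blocks of the right spine of r.
-- An L-block with top node u = node l r, seen as a child of the R-block
-- of u, has as children the R-blocks of the left spine of l.

mutual
  spineW : BT → List PTree
  spineW leaf       = []
  spineW (node l r) = pt (leftChainB l) ∷ spineW r

  leftChainB : BT → List PTree
  leftChainB leaf       = []
  leftChainB (node l r) = leftChainB l ++ [ pt (spineW r) ]

-- φ(T): rooted at the R-block containing the root of T (the right spine).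
φ : BT → PTree
φ t = pt (spineW t)

-- A move L_v, with v = node T₁ (node T₂ R) on a right spine, exchanges the white
-- vertices of φ topped at v and at its right child: two consecutive children of a
-- black vertex.  Nothing else changes, so L-equivalent trees have φ equal up to
-- reordering the children of black vertices.  Conversely φ is a bijection, whose
-- inverse ψ builds a right spine from the children of a black vertex and a left comb
-- from the children of a white vertex; ψ turns an adjacent transposition of black
-- children into a single move, and every reordering is a product of those.
module Submission where

open import Defs
open import Data.Nat using (ℕ; suc; _≤_; _+_)
open import Data.Nat.Properties using (+-assoc; +-identityʳ; +-suc; suc-injective)
open import Data.Product using (_×_; Σ-syntax; _,_)
open import Data.List using (List; []; _∷_; _++_; [_])
open import Data.List.Properties using (++-assoc; ++-identityʳ)
open import Data.List.Relation.Binary.Pointwise using (Pointwise; []; _∷_; ++⁺)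
open import Data.List.Relation.Binary.Permutation.Homogeneous using (Permutation; prep; swap)
import Data.List.Relation.Binary.Permutation.Homogeneous as Perm
open import Relation.Binary.Structures using (IsEquivalence)
open import Relation.Binary.Construct.Closure.Equivalence using (EqClosure; gfold; gmap; return)
open import Relation.Binary.Construct.Closure.ReflexiveTransitive using (ε; _◅◅_)
open import Relation.Binary.PropositionalEquality
  using (_≡_; refl; sym; trans; cong; cong₂; subst; subst₂; module ≡-Reasoning)
open ≡-Reasoning
open import Function.Bundles using (_⇔_; mk⇔)

mutual
  ≈B-refl : ∀ {P} → P ≈B P
  ≈B-refl {pt xs} = black (Perm.refl ≈W-refl-pointwise)

  ≈W-refl : ∀ {P} → P ≈W P
  ≈W-refl {pt xs} = white ≈B-refl-pointwise

  ≈W-refl-pointwise : ∀ {xs} → Pointwise _≈W_ xs xs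
  ≈W-refl-pointwise {[]}     = []
  ≈W-refl-pointwise {x ∷ xs} = ≈W-refl ∷ ≈W-refl-pointwise

  ≈B-refl-pointwise : ∀ {xs} → Pointwise _≈B_ xs xs
  ≈B-refl-pointwise {[]}     = []
  ≈B-refl-pointwise {x ∷ xs} = ≈B-refl ∷ ≈B-refl-pointwise

mutual
  ≈B-sym : ∀ {P Q} → P ≈B Q → Q ≈B P
  ≈B-sym (black p) = black (≈W-sym-permutation p)

  ≈W-sym : ∀ {P Q} → P ≈W Q → Q ≈W P
  ≈W-sym (white p) = white (≈B-sym-pointwise p)

  ≈W-sym-pointwise : ∀ {xs ys} → Pointwise _≈W_ xs ys → Pointwise _≈W_ ys xs
  ≈W-sym-pointwise []       = []
  ≈W-sym-pointwise (e ∷ es) = ≈W-sym e ∷ ≈W-sym-pointwise es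

  ≈B-sym-pointwise : ∀ {xs ys} → Pointwise _≈B_ xs ys → Pointwise _≈B_ ys xs
  ≈B-sym-pointwise []       = []
  ≈B-sym-pointwise (e ∷ es) = ≈B-sym e ∷ ≈B-sym-pointwise es

  ≈W-sym-permutation : ∀ {xs ys} → Permutation _≈W_ xs ys → Permutation _≈W_ ys xs
  ≈W-sym-permutation (Perm.refl es)  = Perm.refl (≈W-sym-pointwise es)
  ≈W-sym-permutation (prep e p)      = prep (≈W-sym e) (≈W-sym-permutation p)
  ≈W-sym-permutation (swap e₁ e₂ p)  = swap (≈W-sym e₂) (≈W-sym e₁) (≈W-sym-permutation p)
  ≈W-sym-permutation (Perm.trans p q) = Perm.trans (≈W-sym-permutation q) (≈W-sym-permutation p)

≈B-trans : ∀ {P Q R} → P ≈B Q → Q ≈B R → P ≈B R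
≈B-trans (black p) (black q) = black (Perm.trans p q)

≈B-isEquivalence : IsEquivalence _≈B_
≈B-isEquivalence = record { refl = ≈B-refl ; sym = ≈B-sym ; trans = ≈B-trans }

mutual
  spineW-stepA : ∀ {t t'} → StepA t t' → Permutation _≈W_ (spineW t) (spineW t')
  spineW-stepA (here t₁ t₂ r) = swap ≈W-refl ≈W-refl (Perm.refl ≈W-refl-pointwise)
  spineW-stepA (left r s)     = prep (white (leftChainB-stepN s)) (Perm.refl ≈W-refl-pointwise)
  spineW-stepA (right l s)    = prep ≈W-refl (spineW-stepA s)

  leftChainB-stepN : ∀ {t t'} → StepN t t' → Pointwise _≈B_ (leftChainB t) (leftChainB t')
  leftChainB-stepN (left r s)  = ++⁺ (leftChainB-stepN s) ≈B-refl-pointwise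
  leftChainB-stepN (right l s) = ++⁺ ≈B-refl-pointwise (black (spineW-stepA s) ∷ [])

∼L⇒φ-≈B : ∀ {T T'} → T ∼L T' → φ T ≈B φ T'
∼L⇒φ-≈B = gfold ≈B-isEquivalence φ (λ s → black (spineW-stepA s))

mutual
  ψ : PTree → BT
  ψ (pt ws) = rightSpine ws

  rightSpine : List PTree → BT
  rightSpine []       = leaf
  rightSpine (w ∷ ws) = node (ψW w) (rightSpine ws)

  ψW : PTree → BT
  ψW (pt bs) = leftComb leaf bs

  leftComb : BT → List PTree → BT
  leftComb acc []       = acc
  leftComb acc (b ∷ bs) = leftComb (node acc (ψ b)) bs

leftComb-++ : ∀ acc xs ys → leftComb acc (xs ++ ys) ≡ leftComb (leftComb acc xs) ys
leftComb-++ acc []       ys = refl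
leftComb-++ acc (x ∷ xs) ys = leftComb-++ (node acc (ψ x)) xs ys

mutual
  spineW-rightSpine : ∀ ws → spineW (rightSpine ws) ≡ ws
  spineW-rightSpine []            = refl
  spineW-rightSpine (pt bs ∷ ws) =
    cong₂ _∷_ (cong pt (leftChainB-leftComb leaf bs)) (spineW-rightSpine ws)

  leftChainB-leftComb : ∀ acc bs → leftChainB (leftComb acc bs) ≡ leftChainB acc ++ bs
  leftChainB-leftComb acc [] = sym (++-identityʳ (leftChainB acc))
  leftChainB-leftComb acc (pt cs ∷ bs) = begin
    leftChainB (leftComb (node acc (rightSpine cs)) bs)
      ≡⟨ leftChainB-leftComb (node acc (rightSpine cs)) bs ⟩
    (leftChainB acc ++ [ pt (spineW (rightSpine cs)) ]) ++ bs
      ≡⟨ cong (λ ws → (leftChainB acc ++ [ pt ws ]) ++ bs) (spineW-rightSpine cs) ⟩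
    (leftChainB acc ++ [ pt cs ]) ++ bs
      ≡⟨ ++-assoc (leftChainB acc) [ pt cs ] bs ⟩
    leftChainB acc ++ pt cs ∷ bs ∎

mutual
  rightSpine-spineW : ∀ t → rightSpine (spineW t) ≡ t
  rightSpine-spineW leaf       = refl
  rightSpine-spineW (node l r) = cong₂ node (leftComb-leftChainB l) (rightSpine-spineW r)

  leftComb-leftChainB : ∀ t → leftComb leaf (leftChainB t) ≡ t
  leftComb-leftChainB leaf       = refl
  leftComb-leftChainB (node l r) = begin
    leftComb leaf (leftChainB l ++ [ pt (spineW r) ])
      ≡⟨ leftComb-++ leaf (leftChainB l) [ pt (spineW r) ] ⟩
    node (leftComb leaf (leftChainB l)) (rightSpine (spineW r))
      ≡⟨ cong₂ node (leftComb-leftChainB l) (rightSpine-spineW r) ⟩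
    node l r ∎

φ-ψ : ∀ P → φ (ψ P) ≡ P
φ-ψ (pt ws) = cong pt (spineW-rightSpine ws)

ψ-φ : ∀ T → ψ (φ T) ≡ T
ψ-φ = rightSpine-spineW

_∼N_ : BT → BT → Set
_∼N_ = EqClosure StepN

∼L-node : ∀ {l l' r r'} → l ∼N l' → r ∼L r' → node l r ∼L node l' r'
∼L-node {l' = l'} {r = r} l∼l' r∼r' =
  gmap (λ x → node x r) (left r) l∼l' ◅◅ gmap (node l') (right l') r∼r'

∼N-node : ∀ {l l' r r'} → l ∼N l' → r ∼L r' → node l r ∼N node l' r'
∼N-node {l' = l'} {r = r} l∼l' r∼r' =
  gmap (λ x → node x r) (left r) l∼l' ◅◅ gmap (node l') (right l') r∼r'

mutual
  ψ-cong : ∀ {P Q} → P ≈B Q → ψ P ∼L ψ Q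
  ψ-cong (black p) = rightSpine-cong-permutation p

  ψW-cong : ∀ {P Q} → P ≈W Q → ψW P ∼N ψW Q
  ψW-cong (white es) = leftComb-cong ε es

  leftComb-cong : ∀ {acc acc' bs cs} → acc ∼N acc' → Pointwise _≈B_ bs cs →
                  leftComb acc bs ∼N leftComb acc' cs
  leftComb-cong a []       = a
  leftComb-cong a (e ∷ es) = leftComb-cong (∼N-node a (ψ-cong e)) es

  rightSpine-cong-pointwise : ∀ {xs ys} → Pointwise _≈W_ xs ys → rightSpine xs ∼L rightSpine ys
  rightSpine-cong-pointwise []       = ε
  rightSpine-cong-pointwise (e ∷ es) = ∼L-node (ψW-cong e) (rightSpine-cong-pointwise es)

  rightSpine-cong-permutation : ∀ {xs ys} → Permutation _≈W_ xs ys → rightSpine xs ∼L rightSpine ys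
  rightSpine-cong-permutation (Perm.refl es) = rightSpine-cong-pointwise es
  rightSpine-cong-permutation (prep e p) = ∼L-node (ψW-cong e) (rightSpine-cong-permutation p)
  rightSpine-cong-permutation {ys = y₂ ∷ y₁ ∷ ys} (swap e₁ e₂ p) =
    ∼L-node (ψW-cong e₁) (∼L-node (ψW-cong e₂) (rightSpine-cong-permutation p))
    ◅◅ return (here (ψW y₁) (ψW y₂) (rightSpine ys))
  rightSpine-cong-permutation (Perm.trans p q) =
    rightSpine-cong-permutation p ◅◅ rightSpine-cong-permutation q

φ-≈B⇒∼L : ∀ {T T'} → φ T ≈B φ T' → T ∼L T'
φ-≈B⇒∼L {T} {T'} e = subst₂ _∼L_ (ψ-φ T) (ψ-φ T') (ψ-cong e)

verticesL-++ : ∀ xs ys → verticesL (xs ++ ys) ≡ verticesL xs + verticesL ys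
verticesL-++ []       ys = refl
verticesL-++ (x ∷ xs) ys =
  trans (cong (vertices x +_) (verticesL-++ xs ys)) (sym (+-assoc (vertices x) _ _))

mutual
  verticesL-spineW : ∀ t → verticesL (spineW t) ≡ nodes t
  verticesL-spineW leaf       = refl
  verticesL-spineW (node l r) = cong suc (cong₂ _+_ (verticesL-leftChainB l) (verticesL-spineW r))

  verticesL-leftChainB : ∀ t → verticesL (leftChainB t) ≡ nodes t
  verticesL-leftChainB leaf       = refl
  verticesL-leftChainB (node l r) = begin
    verticesL (leftChainB l ++ [ pt (spineW r) ])
      ≡⟨ verticesL-++ (leftChainB l) [ pt (spineW r) ] ⟩
    verticesL (leftChainB l) + (suc (verticesL (spineW r)) + 0)
      ≡⟨ cong₂ _+_ (verticesL-leftChainB l) (+-identityʳ _) ⟩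
    nodes l + suc (verticesL (spineW r))
      ≡⟨ cong (λ n → nodes l + suc n) (verticesL-spineW r) ⟩
    nodes l + suc (nodes r)
      ≡⟨ +-suc (nodes l) (nodes r) ⟩
    suc (nodes l + nodes r) ∎

vertices-φ : ∀ T → vertices (φ T) ≡ suc (nodes T)
vertices-φ T = cong suc (verticesL-spineW T)

nodes-ψ : ∀ P → suc (nodes (ψ P)) ≡ vertices P
nodes-ψ P = trans (sym (vertices-φ (ψ P))) (cong vertices (φ-ψ P))

mainTheorem13 : (m : ℕ) → 1 ≤ m →
    ((T T' : BT) → nodes T ≡ m → nodes T' ≡ m → (T ∼L T' ⇔ φ T ≈B φ T'))
    × ((T : BT) → nodes T ≡ m → vertices (φ T) ≡ suc m)
    × ((P : PTree) → vertices P ≡ suc m → Σ[ T ∈ BT ] (nodes T ≡ m × φ T ≈B P))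
mainTheorem13 m _ =
    (λ T T' _ _ → mk⇔ ∼L⇒φ-≈B φ-≈B⇒∼L)
  , (λ T nodes≡m → trans (vertices-φ T) (cong suc nodes≡m))
  , λ P vertices≡1+m →
      ψ P
    , suc-injective (trans (nodes-ψ P) vertices≡1+m)
    , subst (_≈B P) (sym (φ-ψ P)) ≈B-refl
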